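{- Let $\mathfrak p_1,\mathfrak p_2\in D_n^B$ have height sequences $(h^{(1)}_1,\dots,h^{(1)}_{k_1})$ and $(h^{(2)}_1,\dots,h^{(2)}_{k_2})$. Then the relative pseudocomplement $\mathfrak p_1\to\mathfrak p_2$ in $\mathcal{D}_n^B$ is the Dyck path $\mathfrak p\in D_n^B$ with height sequence $(h_1,\dots,h_k)$, where $$k=\begin{cases}k_2,& k_1<k_2, \text{ or } k_1\ge k_2 \text{ and } h^{(1)}_{k_2}>h^{(2)}_{k_2},\\ \max\{i\in[k_2-1]\mid h^{(1)}_i>h^{(2)}_i\}+1,& k_1\ge k_2\text{ and } h^{(1)}_{k_2}\le h^{(2)}_{k_2},\end{cases}$$ (with the convention $\max\emptyset=0$), and the entries are defined recursively from the right as follows. If $k_1<k_2$: $$h_i=\begin{cases}h_{i+1},& i\le k_1\text{ and } h^{(1)}_i\le h^{(2)}_i,\\ h^{(2)}_i,& i>k_1, \text{ or } i\le k_1\text{ and } h^{(1)}_i>h^{(2)}_i.\end{cases}$$ If $k_1\ge k_2$: $$h_i=\begin{cases}2n-k+1,& i=k\text{ and } h^{(1)}_k\le h^{(2)}_k,\\ h_{i+1},& i<k\text{ and } h^{(1)}_i\le h^{(2)}_i,\\ h^{(2)}_i,& i\le k\text{ and } h^{(1)}_i>h^{(2)}_i.\end{cases}$$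
   Context: $D_n^B$ is the set of words (Dyck paths of type $B$) of length $2n$ over $\{u,r\}$ in which every prefix contains at least as many $u$'s as $r$'s. Height sequence of $w\in D_n^B$: let $\rho$ be the number of $r$'s. If $w$ ends with $r$, $k=\rho$ and $h_i$ is the number of $u$'s preceding the $i$-th $r$ (then $h_k=2n-k$); if $w$ ends with $u$, $k=\rho+1$, $h_i$ ($i\le\rho$) as before and $h_k$ is the total number of $u$'s (then $h_k=2n-k+1$). These are exactly the sequences with $k\in[n]$, $h_k\in\{2n-k,2n-k+1\}$, $h_1\le\dots\le h_{k-1}\le 2n-k$ and $h_i\ge i$ for $i\in[k]$. Dominance order: $(h_1,\dots,h_k)\le_D(h'_1,\dots,h'_{k'})$ iff $k\ge k'$ and $h_i\le h'_i$ for $i\in[k']$; $\mathcal{D}_n^B=(D_n^B,\le_D)$ is a distributive lattice, whose meet of sequences of lengths $k\ge k'$ is $(\min\{h_1,h'_1\},\dots,\min\{h_{k'},h'_{k'}\},h_{k'+1},\dots,h_k)$. The relative pseudocomplement $x\to y$ is the greatest $z$ with $x\wedge z\le y$. -}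

module Defs where

open import Data.Nat using (ℕ; zero; suc; _+_; _*_; _∸_; _≤_; _<ᵇ_; _≤ᵇ_; _≡ᵇ_; _⊔_; _⊓_)
open import Data.List using (List; []; _∷_; _++_; length; take)
open import Data.Bool using (Bool; true; false; if_then_else_; _∧_)
open import Data.Product using (_×_; Σ)
open import Relation.Binary.PropositionalEquality using (_≡_)

data Letter : Set where
  u r : Letter

Word : Set
Word = List Letter

countU : Word → ℕ
countU []       = 0
countU (u ∷ w)  = suc (countU w)
countU (r ∷ w)  = countU w

countR : Word → ℕ
countR []       = 0
countR (u ∷ w)  = countR w
countR (r ∷ w)  = suc (countR w)

DyckB : ℕ → Word → Set
DyckB n w = (length w ≡ 2 * n) × (∀ m → countR (take m w) ≤ countU (take m w))

-- c = number of u's read so far; emits, for each r, the number of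
-- u's preceding it
heightsR : ℕ → Word → List ℕ
heightsR c []       = []
heightsR c (u ∷ w)  = heightsR (suc c) w
heightsR c (r ∷ w)  = c ∷ heightsR c w

endsWithU : Word → Bool
endsWithU []           = false
endsWithU (u ∷ [])     = true
endsWithU (r ∷ [])     = false
endsWithU (_ ∷ x ∷ w)  = endsWithU (x ∷ w)

heightSeq : Word → List ℕ
heightSeq w with endsWithU w
... | true  = heightsR 0 w ++ (countU w ∷ [])
... | false = heightsR 0 w

-- 1-based lookup (default 0 outside the range)

get : List ℕ → ℕ → ℕ
get []       _             = 0
get (x ∷ xs) zero          = 0
get (x ∷ xs) (suc zero)    = x
get (x ∷ xs) (suc (suc i)) = get xs (suc i)

_≤D_ : List ℕ → List ℕ → Set
hs ≤D hs' = (length hs' ≤ length hs)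
          × (∀ i → 1 ≤ i → i ≤ length hs' → get hs i ≤ get hs' i)

meetH : List ℕ → List ℕ → List ℕ
meetH []       ys       = ys
meetH xs       []       = xs
meetH (x ∷ xs) (y ∷ ys) = (x ⊓ y) ∷ meetH xs ys

IsRelPseudocomplement : ℕ → Word → Word → Word → Set
IsRelPseudocomplement n x y z =
  DyckB n z
  × (meetH (heightSeq x) (heightSeq z) ≤D heightSeq y)
  × (∀ w → DyckB n w → meetH (heightSeq x) (heightSeq w) ≤D heightSeq y
         → heightSeq w ≤D heightSeq z)

maxBad : List ℕ → List ℕ → ℕ → ℕ
maxBad h1 h2 zero    = 0
maxBad h1 h2 (suc m) =
  if get h2 (suc m) <ᵇ get h1 (suc m) then suc m else maxBad h1 h2 m

rpcLength : List ℕ → List ℕ → ℕ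
rpcLength h1 h2 =
  let k1 = length h1 ; k2 = length h2 in
  if k1 <ᵇ k2 then k2
  else (if get h2 k2 <ᵇ get h1 k2 then k2
        else suc (maxBad h1 h2 (k2 ∸ 1)))

-- build i next acc : computes h_i, …, h_1 from right to left, where
-- step j v gives h_j from v = h_{j+1}; prepends onto acc
build : (ℕ → ℕ → ℕ) → ℕ → ℕ → List ℕ → List ℕ
build step zero    next acc = acc
build step (suc i) next acc =
  build step i (step (suc i) next) (step (suc i) next ∷ acc)

rpcSeq : ℕ → List ℕ → List ℕ → List ℕ
rpcSeq n h1 h2 =
  if k1 <ᵇ k2 then build stepA k 0 [] else build stepB k 0 []
  where
  k1 = length h1
  k2 = length h2
  k  = rpcLength h1 h2
  stepA : ℕ → ℕ → ℕ
  stepA i next =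
    if (i ≤ᵇ k1) ∧ (get h1 i ≤ᵇ get h2 i) then next else get h2 i
  stepB : ℕ → ℕ → ℕ
  stepB i next =
    if i ≡ᵇ k
    then (if get h1 i ≤ᵇ get h2 i then (2 * n ∸ k) + 1 else get h2 i)
    else (if get h1 i ≤ᵇ get h2 i then next else get h2 i)

-- A path is determined by its height sequence and every sequence satisfying IsHeightSeq is one
-- (climb with u's to each height before the corresponding r), so it suffices to find the greatest
-- height sequence z with h₁ ∧ z ≤D h₂, for h₁, h₂ the height sequences of p₁, p₂.
-- Call a position i ≤ k₂ below if i ≤ k₁ and h₁ᵢ ≤ h₂ᵢ.  At a below position the meet stays under
-- h₂ whatever z is; at any other position i ≤ k₂, an admissible z must reach i and satisfy zᵢ ≤ h₂ᵢ.
-- So the greatest z equals h₂ off the below positions and, read from the right, is as large as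
-- monotonicity allows on them: its right neighbour, or the largest last entry 2n − k + 1 at k.
-- Its length k is forced as well: z must reach every position i ≤ k₂ that is not below, and cannot
-- end at such an i < k₂, since a last entry is at least 2n − i while h₂ᵢ ≤ 2n − k₂ < 2n − i.

module Submission where

open import Defs
open import Data.Nat using (ℕ; zero; suc; _+_; _*_; _∸_; _≤_; _<_; z≤n; s≤s; _⊓_; _⊔_; _<ᵇ_; _≤ᵇ_; _≡ᵇ_)
open import Data.Nat.Properties
open import Data.List using (List; []; _∷_; _++_; _∷ʳ_; length; take; replicate; initLast; _∷ʳ′_)
open import Data.List.Properties using (length-++; ++-identityʳ; take-all)
open import Data.Bool using (true; false; if_then_else_; _∧_)
open import Data.Product using (Σ; _×_; _,_; proj₁; proj₂)
open import Data.Sum using (_⊎_; inj₁; inj₂)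
open import Data.Unit using (⊤; tt)
open import Data.Empty using (⊥; ⊥-elim)
open import Function using (_∘_)
open import Relation.Nullary using (¬_; Dec; yes; no; _because_; contradiction)
open import Relation.Nullary.Reflects using (Reflects; ofʸ; ofⁿ; fromEquivalence; _×-reflects_)
open import Relation.Binary.PropositionalEquality

get-0 : ∀ xs → get xs 0 ≡ 0
get-0 []      = refl
get-0 (_ ∷ _) = refl

get-beyond : ∀ xs i → length xs < i → get xs i ≡ 0
get-beyond []       i             _       = refl
get-beyond (x ∷ xs) (suc (suc i)) (s≤s p) = get-beyond xs (suc i) p

get-++ˡ : ∀ xs ys i → i ≤ length xs → get (xs ++ ys) i ≡ get xs i
get-++ˡ []       ys zero          _       = get-0 ys
get-++ˡ (x ∷ xs) ys zero          _       = refl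
get-++ˡ (x ∷ xs) ys (suc zero)    _       = refl
get-++ˡ (x ∷ xs) ys (suc (suc i)) (s≤s p) = get-++ˡ xs ys (suc i) p

get-∷ʳ-last : ∀ xs y → get (xs ∷ʳ y) (suc (length xs)) ≡ y
get-∷ʳ-last []       y = refl
get-∷ʳ-last (x ∷ xs) y = get-∷ʳ-last xs y

length-build : ∀ step k next acc → length (build step k next acc) ≡ k + length acc
length-build step zero    next acc = refl
length-build step (suc k) next acc =
  trans (length-build step k _ (_ ∷ acc)) (+-suc k (length acc))

get-build-acc : ∀ step k next acc i →
  get (build step k next acc) (suc (i + k)) ≡ get acc (suc i)
get-build-acc step zero    next acc i = cong (get acc ∘ suc) (+-identityʳ i)
get-build-acc step (suc k) next acc i =
  trans (cong (get (build step k s (s ∷ acc)) ∘ suc) (+-suc i k))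
        (get-build-acc step k s (s ∷ acc) (suc i))
  where s = step (suc k) next

build-recurrence : ∀ step k next acc → get acc 1 ≡ next → ∀ i → 1 ≤ i → i ≤ k →
  get (build step k next acc) i ≡ step i (get (build step k next acc) (suc i))
build-recurrence step zero    next acc _ _ (s≤s _) ()
build-recurrence step (suc k) next acc acc₁≡next i 1≤i i≤1+k with m≤n⇒m<n∨m≡n i≤1+k
... | inj₁ (s≤s i≤k) = build-recurrence step k _ (_ ∷ acc) refl i 1≤i i≤k
... | inj₂ refl      =
  trans (get-build-acc step k _ (_ ∷ acc) 0)
        (cong (step (suc k)) (sym (trans (get-build-acc step k _ (_ ∷ acc) 1) acc₁≡next)))

downward-induction : (P : ℕ → Set) (k : ℕ) →
  (∀ i → 1 ≤ i → i ≤ k → (i < k → P (suc i)) → P i) →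
  ∀ i → 1 ≤ i → i ≤ k → P i
downward-induction P k step i 1≤i i≤k = go (k ∸ i) i (m+[n∸m]≡n i≤k) 1≤i
  where
  go : ∀ d i → i + d ≡ k → 1 ≤ i → P i
  go zero    i i+0≡k 1≤i = step i 1≤i (≤-reflexive i≡k) (λ i<k → ⊥-elim (<-irrefl i≡k i<k))
    where i≡k = trans (sym (+-identityʳ i)) i+0≡k
  go (suc d) i i+d≡k 1≤i = step i 1≤i (subst (i ≤_) i+d≡k (m≤m+n i (suc d)))
    (λ _ → go d (suc i) (trans (sym (+-suc i d)) i+d≡k) (s≤s z≤n))

stepwise-mono : (f : ℕ → ℕ) (k : ℕ) → (∀ i → 1 ≤ i → suc i ≤ k → f i ≤ f (suc i)) →
  ∀ i j → 1 ≤ i → i ≤ j → j ≤ k → f i ≤ f j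
stepwise-mono f k f-step _ zero    (s≤s _) () _
stepwise-mono f k f-step i (suc j) 1≤i i≤j j≤k with m≤n⇒m<n∨m≡n i≤j
... | inj₂ refl       = ≤-refl
... | inj₁ (s≤s i≤j') = ≤-trans (stepwise-mono f k f-step i j 1≤i i≤j' (≤-trans (n≤1+n j) j≤k))
                                (f-step j (≤-trans 1≤i i≤j') j≤k)

length-meetH : ∀ xs ys → length (meetH xs ys) ≡ length xs ⊔ length ys
length-meetH []       ys       = refl
length-meetH (x ∷ xs) []       = refl
length-meetH (x ∷ xs) (y ∷ ys) = cong suc (length-meetH xs ys)

get-meetH : ∀ xs ys i → 1 ≤ i → i ≤ length xs → i ≤ length ys →
  get (meetH xs ys) i ≡ get xs i ⊓ get ys i
get-meetH (x ∷ xs) (y ∷ ys) (suc zero)    _ _       _       = refl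
get-meetH (x ∷ xs) (y ∷ ys) (suc (suc i)) _ (s≤s p) (s≤s q) = get-meetH xs ys (suc i) (s≤s z≤n) p q

get-meetH-≤ˡ : ∀ xs ys i → i ≤ length xs → get (meetH xs ys) i ≤ get xs i
get-meetH-≤ˡ []       ys       zero          _       = ≤-reflexive (get-0 ys)
get-meetH-≤ˡ (x ∷ xs) []       i             _       = ≤-refl
get-meetH-≤ˡ (x ∷ xs) (y ∷ ys) zero          _       = z≤n
get-meetH-≤ˡ (x ∷ xs) (y ∷ ys) (suc zero)    _       = m⊓n≤m x y
get-meetH-≤ˡ (x ∷ xs) (y ∷ ys) (suc (suc i)) (s≤s p) = get-meetH-≤ˡ xs ys (suc i) p

get-meetH-≤ʳ : ∀ xs ys i → i ≤ length ys → get (meetH xs ys) i ≤ get ys i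
get-meetH-≤ʳ []       ys       i             _       = ≤-refl
get-meetH-≤ʳ (x ∷ xs) []       zero          _       = z≤n
get-meetH-≤ʳ (x ∷ xs) (y ∷ ys) zero          _       = z≤n
get-meetH-≤ʳ (x ∷ xs) (y ∷ ys) (suc zero)    _       = m⊓n≤n x y
get-meetH-≤ʳ (x ∷ xs) (y ∷ ys) (suc (suc i)) (s≤s p) = get-meetH-≤ʳ xs ys (suc i) p

get-meetH-beyondʳ : ∀ xs ys i → length ys < i → get (meetH xs ys) i ≡ get xs i
get-meetH-beyondʳ []       []       i             _       = refl
get-meetH-beyondʳ []       (y ∷ ys) i             p       = get-beyond (y ∷ ys) i p
get-meetH-beyondʳ (x ∷ xs) []       i             _       = refl
get-meetH-beyondʳ (x ∷ xs) (y ∷ ys) (suc (suc i)) (s≤s p) = get-meetH-beyondʳ xs ys (suc i) p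

get-meetH-beyondˡ : ∀ xs ys i → length xs < i → get (meetH xs ys) i ≡ get ys i
get-meetH-beyondˡ []       ys       i             _       = refl
get-meetH-beyondˡ (x ∷ xs) []       i             p       = get-beyond (x ∷ xs) i p
get-meetH-beyondˡ (x ∷ xs) (y ∷ ys) (suc (suc i)) (s≤s p) = get-meetH-beyondˡ xs ys (suc i) p

suc[n∸1]≡n : ∀ {n} → 1 ≤ n → suc (n ∸ 1) ≡ n
suc[n∸1]≡n (s≤s _) = refl

m<n⇒m≤n∸1 : ∀ {m n} → m < n → m ≤ n ∸ 1
m<n⇒m≤n∸1 (s≤s m≤n) = m≤n

m⊓n≤o⇒o<m⇒n≤o : ∀ {m n o} → m ⊓ n ≤ o → o < m → n ≤ o
m⊓n≤o⇒o<m⇒n≤o {m} {n} m⊓n≤o o<m with ≤-total m n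
... | inj₁ m≤n = contradiction (subst (_≤ _) (m≤n⇒m⊓n≡m m≤n) m⊓n≤o) (<⇒≱ o<m)
... | inj₂ n≤m = subst (_≤ _) (m≥n⇒m⊓n≡n n≤m) m⊓n≤o

m∸n+1+n≡1+m : ∀ m n → n ≤ m → (m ∸ n + 1) + n ≡ suc m
m∸n+1+n≡1+m m n n≤m = trans (+-assoc (m ∸ n) 1 n) (trans (+-suc (m ∸ n) n) (cong suc (m∸n+n≡m n≤m)))

m+n≤1+o⇒m≤o∸n+1 : ∀ m n o → n ≤ o → m + n ≤ suc o → m ≤ o ∸ n + 1
m+n≤1+o⇒m≤o∸n+1 m n o n≤o m+n≤1+o =
  +-cancelʳ-≤ n m (o ∸ n + 1) (subst (m + n ≤_) (sym (m∸n+1+n≡1+m o n n≤o)) m+n≤1+o)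

-- The bound h_i ≤ 2n − k is written h_i + k ≤ 2n to avoid truncated subtraction.
record IsHeightSeq (n : ℕ) (h : List ℕ) : Set where
  field
    length-pos : 1 ≤ length h
    length-≤   : length h ≤ n
    ascending  : ∀ i → 1 ≤ i → suc i ≤ length h → get h i ≤ get h (suc i)
    above-diag : ∀ i → 1 ≤ i → i ≤ length h → i ≤ get h i
    inner-≤    : ∀ i → 1 ≤ i → i < length h → get h i + length h ≤ 2 * n
    last-≥     : 2 * n ≤ get h (length h) + length h
    last-≤     : get h (length h) + length h ≤ suc (2 * n)

module _ {n : ℕ} {h : List ℕ} (H : IsHeightSeq n h) where
  open IsHeightSeq H

  length-≤2n : length h ≤ 2 * n
  length-≤2n = ≤-trans length-≤ (m≤m+n n (n + 0))

  entry+index-≤ : ∀ i → 1 ≤ i → i ≤ length h → get h i + i ≤ suc (2 * n)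
  entry+index-≤ i 1≤i i≤k with m≤n⇒m<n∨m≡n i≤k
  ... | inj₁ i<k  = ≤-trans (+-monoʳ-≤ (get h i) (<⇒≤ i<k)) (≤-trans (inner-≤ i 1≤i i<k) (n≤1+n _))
  ... | inj₂ refl = last-≤

last>inner : ∀ {n h h'} → IsHeightSeq n h → IsHeightSeq n h' → length h < length h' →
  get h' (length h) < get h (length h)
last>inner {n} {h} {h'} H H' k<k' =
  +-cancelʳ-< (length h) (get h' (length h)) (get h (length h))
    (<-≤-trans (+-monoʳ-< (get h' (length h)) k<k')
               (≤-trans (IsHeightSeq.inner-≤ H' (length h) (IsHeightSeq.length-pos H) k<k')
                        (IsHeightSeq.last-≥ H)))

Below : List ℕ → List ℕ → ℕ → Set
Below h₁ h₂ i = i ≤ length h₁ × get h₁ i ≤ get h₂ i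

below-reflects : ∀ h₁ h₂ i → Reflects (Below h₁ h₂ i) ((i ≤ᵇ length h₁) ∧ (get h₁ i ≤ᵇ get h₂ i))
below-reflects h₁ h₂ i = ≤ᵇ-reflects-≤ i (length h₁) ×-reflects ≤ᵇ-reflects-≤ (get h₁ i) (get h₂ i)

below? : ∀ h₁ h₂ i → Dec (Below h₁ h₂ i)
below? h₁ h₂ i = _ because below-reflects h₁ h₂ i

meetH≤D-notBelow : ∀ h₁ h₂ h → meetH h₁ h ≤D h₂ → ∀ i → 1 ≤ i → i ≤ length h₂ →
  ¬ Below h₁ h₂ i → i ≤ length h × get h i ≤ get h₂ i
meetH≤D-notBelow h₁ h₂ h (k₂≤ , meet≤) i 1≤i i≤k₂ ¬below with i ≤? length h₁ | i ≤? length h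
... | yes i≤k₁ | yes i≤m =
  i≤m , m⊓n≤o⇒o<m⇒n≤o (subst (_≤ get h₂ i) (get-meetH h₁ h i 1≤i i≤k₁ i≤m) (meet≤ i 1≤i i≤k₂))
                       (≰⇒> (λ a≤b → ¬below (i≤k₁ , a≤b)))
... | yes i≤k₁ | no i≰m =
  contradiction (i≤k₁ , subst (_≤ get h₂ i) (get-meetH-beyondʳ h₁ h i (≰⇒> i≰m)) (meet≤ i 1≤i i≤k₂))
                ¬below
... | no i≰k₁  | _ =
  ≮⇒≥ (λ m<i → <⇒≱ (⊔-lub (≰⇒> i≰k₁) m<i)
                    (≤-trans i≤k₂ (subst (length h₂ ≤_) (length-meetH h₁ h) k₂≤))) ,
  subst (_≤ get h₂ i) (get-meetH-beyondˡ h₁ h i (≰⇒> i≰k₁)) (meet≤ i 1≤i i≤k₂)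

record RpcLength (h₁ h₂ : List ℕ) (k : ℕ) : Set where
  field
    1≤k         : 1 ≤ k
    k≤k₂        : k ≤ length h₂
    k₁<k₂⇒k≡k₂  : length h₁ < length h₂ → k ≡ length h₂
    below-at    : k < length h₂ → Below h₁ h₂ k
    below-after : ∀ i → k < i → i ≤ length h₂ → Below h₁ h₂ i
    -- No shorter sequence can work: position k = k₂, or else position k − 1 (if k > 1), is not below.
    forced      : (k ≡ length h₂ × ¬ Below h₁ h₂ k)
                ⊎ (1 ≤ k ∸ 1 → ¬ Below h₁ h₂ (k ∸ 1))

record RpcCandidate (n : ℕ) (h₁ h₂ z : List ℕ) : Set where
  field
    rpcLength-ok : RpcLength h₁ h₂ (length z)
    at-below     : ∀ i → 1 ≤ i → i < length z → Below h₁ h₂ i → get z i ≡ get z (suc i)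
    at-top       : Below h₁ h₂ (length z) → get z (length z) ≡ 2 * n ∸ length z + 1
    at-notBelow  : ∀ i → 1 ≤ i → i ≤ length z → ¬ Below h₁ h₂ i → get z i ≡ get h₂ i

module RpcCandidateProperties {n : ℕ} {h₁ h₂ z : List ℕ}
  (H₁ : IsHeightSeq n h₁) (H₂ : IsHeightSeq n h₂) (C : RpcCandidate n h₁ h₂ z) where

  open RpcCandidate C
  open RpcLength rpcLength-ok
  private
    module H₁ = IsHeightSeq H₁
    module H₂ = IsHeightSeq H₂
    k  = length z
    k₁ = length h₁
    k₂ = length h₂

  k≤2n : k ≤ 2 * n
  k≤2n = ≤-trans k≤k₂ (length-≤2n H₂)

  meetH-≤D : meetH h₁ z ≤D h₂
  meetH-≤D = subst (k₂ ≤_) (sym (length-meetH h₁ z)) k₂≤k₁⊔k , meet≤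
    where
    k₂≤k₁⊔k : k₂ ≤ k₁ ⊔ k
    k₂≤k₁⊔k with k₁ <? k₂
    ... | yes k₁<k₂ = subst (_≤ k₁ ⊔ k) (k₁<k₂⇒k≡k₂ k₁<k₂) (m≤n⊔m k₁ k)
    ... | no  k₁≮k₂ = ≤-trans (≮⇒≥ k₁≮k₂) (m≤m⊔n k₁ k)
    meet≤ : ∀ i → 1 ≤ i → i ≤ k₂ → get (meetH h₁ z) i ≤ get h₂ i
    meet≤ i 1≤i i≤k₂ with below? h₁ h₂ i
    ... | yes (i≤k₁ , a≤b) = ≤-trans (get-meetH-≤ˡ h₁ z i i≤k₁) a≤b
    ... | no ¬below = ≤-trans (get-meetH-≤ʳ h₁ z i i≤k) (≤-reflexive (at-notBelow i 1≤i i≤k ¬below))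
      where
      i≤k = ≮⇒≥ (λ k<i → ¬below (below-after i k<i i≤k₂))

  module _ {h : List ℕ} (H : IsHeightSeq n h) (meet≤ : meetH h₁ h ≤D h₂) where
    private
      module H = IsHeightSeq H
      m = length h

    k≤length : k ≤ m
    k≤length with forced
    ... | inj₁ (_ , ¬below-k) = proj₁ (meetH≤D-notBelow h₁ h₂ h meet≤ k 1≤k k≤k₂ ¬below-k)
    ... | inj₂ ¬below-pred    = ≮⇒≥ shorter-impossible
      where
      shorter-impossible : m < k → ⊥
      shorter-impossible m<k =
        <⇒≱ (last>inner H H₂ (<-≤-trans m<k k≤k₂)) (subst (λ j → get h j ≤ get h₂ j) (sym m≡pred) c≤b)
        where
        1≤pred = ≤-trans H.length-pos (m<n⇒m≤n∸1 m<k)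
        pred≤m×c≤b = meetH≤D-notBelow h₁ h₂ h meet≤ (k ∸ 1) 1≤pred (≤-trans (m∸n≤m k 1) k≤k₂)
                       (¬below-pred 1≤pred)
        c≤b = proj₂ pred≤m×c≤b
        m≡pred = ≤-antisym (m<n⇒m≤n∸1 m<k) (proj₁ pred≤m×c≤b)

    get-≤-z : ∀ i → 1 ≤ i → i ≤ k → get h i ≤ get z i
    get-≤-z = downward-induction (λ i → get h i ≤ get z i) k step
      where
      step : ∀ i → 1 ≤ i → i ≤ k → (i < k → get h (suc i) ≤ get z (suc i)) → get h i ≤ get z i
      step i 1≤i i≤k ih with below? h₁ h₂ i | m≤n⇒m<n∨m≡n i≤k
      ... | no ¬below | _ =
        subst (get h i ≤_) (sym (at-notBelow i 1≤i i≤k ¬below))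
          (proj₂ (meetH≤D-notBelow h₁ h₂ h meet≤ i 1≤i (≤-trans i≤k k≤k₂) ¬below))
      ... | yes below | inj₁ i<k =
        subst (get h i ≤_) (sym (at-below i 1≤i i<k below))
          (≤-trans (H.ascending i 1≤i (≤-trans i<k k≤length)) (ih i<k))
      ... | yes below | inj₂ refl =
        subst (get h k ≤_) (sym (at-top below))
          (m+n≤1+o⇒m≤o∸n+1 (get h k) k (2 * n) k≤2n (entry+index-≤ H k 1≤k k≤length))

    ≤D-z : h ≤D z
    ≤D-z = k≤length , get-≤-z

  h₂-≤-z : ∀ l → 1 ≤ l → l ≤ k → ∀ i → 1 ≤ i → i ≤ l → get h₂ i ≤ get z l
  h₂-≤-z = downward-induction (λ l → ∀ i → 1 ≤ i → i ≤ l → get h₂ i ≤ get z l) k step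
    where
    h₂-mono = stepwise-mono (get h₂) k₂ H₂.ascending
    step : ∀ l → 1 ≤ l → l ≤ k → (l < k → ∀ i → 1 ≤ i → i ≤ suc l → get h₂ i ≤ get z (suc l)) →
           ∀ i → 1 ≤ i → i ≤ l → get h₂ i ≤ get z l
    step l 1≤l l≤k ih i 1≤i i≤l with below? h₁ h₂ l | m≤n⇒m<n∨m≡n l≤k
    ... | no ¬below | _ =
      subst (get h₂ i ≤_) (sym (at-notBelow l 1≤l l≤k ¬below)) (h₂-mono i l 1≤i i≤l (≤-trans l≤k k≤k₂))
    ... | yes below | inj₁ l<k =
      subst (get h₂ i ≤_) (sym (at-below l 1≤l l<k below)) (ih l<k i 1≤i (m≤n⇒m≤1+n i≤l))
    ... | yes below | inj₂ refl =
      subst (get h₂ i ≤_) (sym (at-top below))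
        (≤-trans (h₂-mono i k 1≤i i≤l k≤k₂)
                 (m+n≤1+o⇒m≤o∸n+1 (get h₂ k) k (2 * n) k≤2n (entry+index-≤ H₂ k 1≤k k≤k₂)))

  z-ascending : ∀ i → 1 ≤ i → suc i ≤ k → get z i ≤ get z (suc i)
  z-ascending i 1≤i i<k with below? h₁ h₂ i
  ... | yes below = ≤-reflexive (at-below i 1≤i i<k below)
  ... | no ¬below = subst (_≤ get z (suc i)) (sym (at-notBelow i 1≤i (<⇒≤ i<k) ¬below))
                      (h₂-≤-z (suc i) (s≤s z≤n) i<k i 1≤i (n≤1+n i))

  z-above-diag : ∀ i → 1 ≤ i → i ≤ k → i ≤ get z i
  z-above-diag i 1≤i i≤k =
    ≤-trans (H₂.above-diag i 1≤i (≤-trans i≤k k≤k₂)) (h₂-≤-z i 1≤i i≤k i 1≤i ≤-refl)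

  pred<k : k ∸ 1 < k
  pred<k = ≤-reflexive (suc[n∸1]≡n 1≤k)

  z-pred-inner-≤ : 1 ≤ k ∸ 1 → get z (k ∸ 1) + k ≤ 2 * n
  z-pred-inner-≤ 1≤pred with below? h₁ h₂ (k ∸ 1)
  ... | no ¬below =
    subst (λ v → v + k ≤ 2 * n) (sym (at-notBelow (k ∸ 1) 1≤pred (<⇒≤ pred<k) ¬below))
      (≤-trans (+-monoʳ-≤ (get h₂ (k ∸ 1)) k≤k₂) (H₂.inner-≤ (k ∸ 1) 1≤pred (<-≤-trans pred<k k≤k₂)))
  ... | yes below@(pred≤k₁ , a≤b) with forced
  ...   | inj₂ ¬below-pred = contradiction below (¬below-pred 1≤pred)
  ...   | inj₁ (_ , ¬below-k) =
    subst (λ v → v + k ≤ 2 * n) (sym z-pred≡b-k) b-k+k≤2n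
    where
    z-pred≡b-k : get z (k ∸ 1) ≡ get h₂ k
    z-pred≡b-k = trans (at-below (k ∸ 1) 1≤pred pred<k below)
                       (trans (cong (get z) (suc[n∸1]≡n 1≤k)) (at-notBelow k 1≤k ≤-refl ¬below-k))
    b-k+k≤2n : get h₂ k + k ≤ 2 * n
    b-k+k≤2n with k ≤? k₁
    ... | yes k≤k₁ = ≤-pred (≤-trans (+-monoˡ-< k (≰⇒> (λ a≤b → ¬below-k (k≤k₁ , a≤b))))
                                     (entry+index-≤ H₁ k 1≤k k≤k₁))
    ... | no  k≰k₁ = contradiction (subst (λ j → get h₁ j ≤ get h₂ j) pred≡k₁ a≤b)
                       (<⇒≱ (last>inner H₁ H₂ (<-≤-trans (≰⇒> k≰k₁) k≤k₂)))
      where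
      pred≡k₁ : k ∸ 1 ≡ k₁
      pred≡k₁ = ≤-antisym pred≤k₁ (m<n⇒m≤n∸1 (≰⇒> k≰k₁))

  z-inner-≤ : ∀ i → 1 ≤ i → i < k → get z i + k ≤ 2 * n
  z-inner-≤ i 1≤i i<k = ≤-trans (+-monoˡ-≤ k z-i≤z-pred) (z-pred-inner-≤ (≤-trans 1≤i i≤pred))
    where
    i≤pred = m<n⇒m≤n∸1 i<k
    z-i≤z-pred = stepwise-mono (get z) k z-ascending i (k ∸ 1) 1≤i i≤pred (<⇒≤ pred<k)

  z-last : 2 * n ≤ get z k + k × get z k + k ≤ suc (2 * n)
  z-last with below? h₁ h₂ k
  ... | yes below rewrite at-top below | m∸n+1+n≡1+m (2 * n) k k≤2n = n≤1+n _ , ≤-refl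
  ... | no ¬below rewrite at-notBelow k 1≤k ≤-refl ¬below =
    subst (λ j → 2 * n ≤ get h₂ j + j × get h₂ j + j ≤ suc (2 * n)) (sym k≡k₂) (H₂.last-≥ , H₂.last-≤)
    where
    k≡k₂ = ≤-antisym k≤k₂ (≮⇒≥ (λ k<k₂ → ¬below (below-at k<k₂)))

  isHeightSeq : IsHeightSeq n z
  isHeightSeq = record
    { length-pos = 1≤k
    ; length-≤   = ≤-trans k≤k₂ H₂.length-≤
    ; ascending  = z-ascending
    ; above-diag = z-above-diag
    ; inner-≤    = z-inner-≤
    ; last-≥     = proj₁ z-last
    ; last-≤     = proj₂ z-last
    }

if-reflects-yes : ∀ {P A : Set} {b} {x y : A} → Reflects P b → P → (if b then x else y) ≡ x
if-reflects-yes (ofʸ _)  _ = refl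
if-reflects-yes (ofⁿ ¬p) p = contradiction p ¬p

if-reflects-no : ∀ {P A : Set} {b} {x y : A} → Reflects P b → ¬ P → (if b then x else y) ≡ y
if-reflects-no (ofʸ p) ¬p = contradiction p ¬p
if-reflects-no (ofⁿ _) _  = refl

≡ᵇ-reflects-≡ : ∀ m n → Reflects (m ≡ n) (m ≡ᵇ n)
≡ᵇ-reflects-≡ m n = fromEquivalence (≡ᵇ⇒≡ m n) (≡⇒≡ᵇ m n)

module _ {n : ℕ} {h₁ h₂ : List ℕ} (k : ℕ) (step : ℕ → ℕ → ℕ) (L : RpcLength h₁ h₂ k)
  (step-below    : ∀ i v → 1 ≤ i → i < k → Below h₁ h₂ i → step i v ≡ v)
  (step-top      : ∀ v → Below h₁ h₂ k → step k v ≡ 2 * n ∸ k + 1)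
  (step-notBelow : ∀ i v → 1 ≤ i → i ≤ k → ¬ Below h₁ h₂ i → step i v ≡ get h₂ i) where

  private
    z = build step k 0 []
    length-z : length z ≡ k
    length-z = trans (length-build step k 0 []) (+-identityʳ k)
    recurrence = build-recurrence step k 0 [] refl

  build-rpcCandidate : RpcCandidate n h₁ h₂ z
  RpcCandidate.rpcLength-ok build-rpcCandidate rewrite length-z = L
  RpcCandidate.at-below build-rpcCandidate i 1≤i i<k below rewrite length-z =
    trans (recurrence i 1≤i (<⇒≤ i<k)) (step-below i _ 1≤i i<k below)
  RpcCandidate.at-top build-rpcCandidate below rewrite length-z =
    trans (recurrence k (RpcLength.1≤k L) ≤-refl) (step-top _ below)
  RpcCandidate.at-notBelow build-rpcCandidate i 1≤i i≤k ¬below rewrite length-z =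
    trans (recurrence i 1≤i i≤k) (step-notBelow i _ 1≤i i≤k ¬below)

-- The step functions local to rpcSeq; they agree definitionally with the originals.
stepA : List ℕ → List ℕ → ℕ → ℕ → ℕ
stepA h₁ h₂ i next = if (i ≤ᵇ length h₁) ∧ (get h₁ i ≤ᵇ get h₂ i) then next else get h₂ i

stepB : ℕ → List ℕ → List ℕ → ℕ → ℕ → ℕ → ℕ
stepB n h₁ h₂ k i next =
  if i ≡ᵇ k
  then (if get h₁ i ≤ᵇ get h₂ i then (2 * n ∸ k) + 1 else get h₂ i)
  else (if get h₁ i ≤ᵇ get h₂ i then next else get h₂ i)

module _ (h₁ h₂ : List ℕ) where

  stepA-below : ∀ i v → Below h₁ h₂ i → stepA h₁ h₂ i v ≡ v
  stepA-below i v = if-reflects-yes (below-reflects h₁ h₂ i)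

  stepA-notBelow : ∀ i v → ¬ Below h₁ h₂ i → stepA h₁ h₂ i v ≡ get h₂ i
  stepA-notBelow i v = if-reflects-no (below-reflects h₁ h₂ i)

  module _ (n k : ℕ) where

    stepB-below : ∀ i v → i < k → Below h₁ h₂ i → stepB n h₁ h₂ k i v ≡ v
    stepB-below i v i<k (_ , a≤b) =
      trans (if-reflects-no (≡ᵇ-reflects-≡ i k) (<⇒≢ i<k)) (if-reflects-yes (≤ᵇ-reflects-≤ _ _) a≤b)

    stepB-top : ∀ v → Below h₁ h₂ k → stepB n h₁ h₂ k k v ≡ 2 * n ∸ k + 1
    stepB-top v (_ , a≤b) =
      trans (if-reflects-yes (≡ᵇ-reflects-≡ k k) refl) (if-reflects-yes (≤ᵇ-reflects-≤ _ _) a≤b)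

    stepB-notBelow : ∀ i v → i ≤ length h₁ → ¬ Below h₁ h₂ i → stepB n h₁ h₂ k i v ≡ get h₂ i
    stepB-notBelow i v i≤k₁ ¬below with i ≡ᵇ k
    ... | true  = if-reflects-no (≤ᵇ-reflects-≤ _ _) (λ a≤b → ¬below (i≤k₁ , a≤b))
    ... | false = if-reflects-no (≤ᵇ-reflects-≤ _ _) (λ a≤b → ¬below (i≤k₁ , a≤b))

module _ (h₁ h₂ : List ℕ) where

  maxBad-≤ : ∀ m → maxBad h₁ h₂ m ≤ m
  maxBad-≤ zero    = ≤-refl
  maxBad-≤ (suc m) with get h₂ (suc m) <ᵇ get h₁ (suc m)
  ... | true  = ≤-refl
  ... | false = m≤n⇒m≤1+n (maxBad-≤ m)

  maxBad-bad : ∀ m → 1 ≤ maxBad h₁ h₂ m → get h₂ (maxBad h₁ h₂ m) < get h₁ (maxBad h₁ h₂ m)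
  maxBad-bad zero    ()
  maxBad-bad (suc m) 1≤mb
    with get h₂ (suc m) <ᵇ get h₁ (suc m) | <ᵇ-reflects-< (get h₂ (suc m)) (get h₁ (suc m))
  ... | true  | ofʸ b<a = b<a
  ... | false | _       = maxBad-bad m 1≤mb

  maxBad-good : ∀ m i → maxBad h₁ h₂ m < i → i ≤ m → get h₁ i ≤ get h₂ i
  maxBad-good zero    i 0<i i≤0 = contradiction i≤0 (<⇒≱ 0<i)
  maxBad-good (suc m) i mb<i i≤1+m
    with get h₂ (suc m) <ᵇ get h₁ (suc m) | <ᵇ-reflects-< (get h₂ (suc m)) (get h₁ (suc m))
       | m≤n⇒m<n∨m≡n i≤1+m
  ... | true  | _        | _                = contradiction i≤1+m (<⇒≱ mb<i)
  ... | false | _        | inj₁ (s≤s i≤m)   = maxBad-good m i mb<i i≤m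
  ... | false | ofⁿ b≮a  | inj₂ refl        = ≮⇒≥ b≮a

rpcLength-full : ∀ {h₁ h₂} → 1 ≤ length h₂ → ¬ Below h₁ h₂ (length h₂) → RpcLength h₁ h₂ (length h₂)
rpcLength-full 1≤k₂ ¬below = record
  { 1≤k         = 1≤k₂
  ; k≤k₂        = ≤-refl
  ; k₁<k₂⇒k≡k₂  = λ _ → refl
  ; below-at    = λ k₂<k₂ → contradiction refl (<⇒≢ k₂<k₂)
  ; below-after = λ i k₂<i i≤k₂ → contradiction i≤k₂ (<⇒≱ k₂<i)
  ; forced      = inj₁ (refl , ¬below)
  }

module _ {h₁ h₂ : List ℕ} (1≤k₂ : 1 ≤ length h₂) (k₂≤k₁ : length h₂ ≤ length h₁)
  (below-k₂ : Below h₁ h₂ (length h₂)) where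

  private
    k₂ = length h₂
    j  = maxBad h₁ h₂ (k₂ ∸ 1)

  below-after-maxBad : ∀ i → j < i → i ≤ k₂ → Below h₁ h₂ i
  below-after-maxBad i j<i i≤k₂ with m≤n⇒m<n∨m≡n i≤k₂
  ... | inj₁ i<k₂ = ≤-trans i≤k₂ k₂≤k₁ , maxBad-good h₁ h₂ (k₂ ∸ 1) i j<i (m<n⇒m≤n∸1 i<k₂)
  ... | inj₂ refl = below-k₂

  rpcLength-short : RpcLength h₁ h₂ (suc j)
  rpcLength-short = record
    { 1≤k         = s≤s z≤n
    ; k≤k₂        = subst (suc j ≤_) (suc[n∸1]≡n 1≤k₂) (s≤s (maxBad-≤ h₁ h₂ (k₂ ∸ 1)))
    ; k₁<k₂⇒k≡k₂  = λ k₁<k₂ → contradiction k₂≤k₁ (<⇒≱ k₁<k₂)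
    ; below-at    = λ j<k₂ → below-after-maxBad (suc j) ≤-refl (<⇒≤ j<k₂)
    ; below-after = λ i j<i → below-after-maxBad i (<-trans (n<1+n j) j<i)
    ; forced      = inj₂ (λ 1≤j (_ , a≤b) → <⇒≱ (maxBad-bad h₁ h₂ (k₂ ∸ 1) 1≤j) a≤b)
    }

rpcLength-spec : ∀ {h₁ h₂} → 1 ≤ length h₂ → RpcLength h₁ h₂ (rpcLength h₁ h₂)
rpcLength-spec {h₁} {h₂} 1≤k₂
  with length h₁ <ᵇ length h₂ | <ᵇ-reflects-< (length h₁) (length h₂)
... | true  | ofʸ k₁<k₂ = rpcLength-full 1≤k₂ (λ (k₂≤k₁ , _) → <⇒≱ k₁<k₂ k₂≤k₁)
... | false | ofⁿ k₁≮k₂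
  with get h₂ (length h₂) <ᵇ get h₁ (length h₂) | <ᵇ-reflects-< (get h₂ (length h₂)) (get h₁ (length h₂))
...   | true  | ofʸ b<a  = rpcLength-full 1≤k₂ (λ (_ , a≤b) → <⇒≱ b<a a≤b)
...   | false | ofⁿ b≮a = rpcLength-short 1≤k₂ (≮⇒≥ k₁≮k₂) (≮⇒≥ k₁≮k₂ , ≮⇒≥ b≮a)

module _ {n : ℕ} {h₁ h₂ : List ℕ} {k : ℕ} (L : RpcLength h₁ h₂ k) where
  open RpcLength L

  stepA-rpcCandidate : length h₁ < length h₂ → RpcCandidate n h₁ h₂ (build (stepA h₁ h₂) k 0 [])
  stepA-rpcCandidate k₁<k₂ = build-rpcCandidate k (stepA h₁ h₂) L
    (λ i v _ _ → stepA-below h₁ h₂ i v)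
    (λ v (k≤k₁ , _) → contradiction (subst (_≤ length h₁) (k₁<k₂⇒k≡k₂ k₁<k₂) k≤k₁) (<⇒≱ k₁<k₂))
    (λ i v _ _ → stepA-notBelow h₁ h₂ i v)

  stepB-rpcCandidate : length h₂ ≤ length h₁ → RpcCandidate n h₁ h₂ (build (stepB n h₁ h₂ k) k 0 [])
  stepB-rpcCandidate k₂≤k₁ = build-rpcCandidate k (stepB n h₁ h₂ k) L
    (λ i v _ i<k → stepB-below h₁ h₂ n k i v i<k)
    (stepB-top h₁ h₂ n k)
    (λ i v _ i≤k → stepB-notBelow h₁ h₂ n k i v (≤-trans i≤k (≤-trans k≤k₂ k₂≤k₁)))

rpcSeq-rpcCandidate : ∀ {n h₁ h₂} → 1 ≤ length h₂ → RpcCandidate n h₁ h₂ (rpcSeq n h₁ h₂)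
rpcSeq-rpcCandidate {n} {h₁} {h₂} 1≤k₂ with length h₁ <? length h₂
... | yes k₁<k₂ = subst (RpcCandidate n h₁ h₂) (sym (if-reflects-yes (<ᵇ-reflects-< _ _) k₁<k₂))
                    (stepA-rpcCandidate (rpcLength-spec 1≤k₂) k₁<k₂)
... | no  k₁≮k₂ = subst (RpcCandidate n h₁ h₂) (sym (if-reflects-no (<ᵇ-reflects-< _ _) k₁≮k₂))
                    (stepB-rpcCandidate (rpcLength-spec 1≤k₂) (≮⇒≥ k₁≮k₂))

countU-++ : ∀ xs ys → countU (xs ++ ys) ≡ countU xs + countU ys
countU-++ []       ys = refl
countU-++ (u ∷ xs) ys = cong suc (countU-++ xs ys)
countU-++ (r ∷ xs) ys = countU-++ xs ys

countR-++ : ∀ xs ys → countR (xs ++ ys) ≡ countR xs + countR ys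
countR-++ []       ys = refl
countR-++ (u ∷ xs) ys = countR-++ xs ys
countR-++ (r ∷ xs) ys = cong suc (countR-++ xs ys)

length≡countU+countR : ∀ w → length w ≡ countU w + countR w
length≡countU+countR []      = refl
length≡countU+countR (u ∷ w) = cong suc (length≡countU+countR w)
length≡countU+countR (r ∷ w) = trans (cong suc (length≡countU+countR w)) (sym (+-suc (countU w) (countR w)))

countU-replicate-u : ∀ m → countU (replicate m u) ≡ m
countU-replicate-u zero    = refl
countU-replicate-u (suc m) = cong suc (countU-replicate-u m)

countR-replicate-u : ∀ m → countR (replicate m u) ≡ 0
countR-replicate-u zero    = refl
countR-replicate-u (suc m) = countR-replicate-u m

heightsR-++ : ∀ c xs ys → heightsR c (xs ++ ys) ≡ heightsR c xs ++ heightsR (c + countU xs) ys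
heightsR-++ c []       ys = cong (λ c' → heightsR c' ys) (sym (+-identityʳ c))
heightsR-++ c (u ∷ xs) ys =
  trans (heightsR-++ (suc c) xs ys) (cong (λ c' → heightsR (suc c) xs ++ heightsR c' ys) (sym (+-suc c (countU xs))))
heightsR-++ c (r ∷ xs) ys = cong (c ∷_) (heightsR-++ c xs ys)

heightsR-replicate-u : ∀ c m → heightsR c (replicate m u) ≡ []
heightsR-replicate-u c zero    = refl
heightsR-replicate-u c (suc m) = heightsR-replicate-u (suc c) m

length-heightsR : ∀ c w → length (heightsR c w) ≡ countR w
length-heightsR c []      = refl
length-heightsR c (u ∷ w) = length-heightsR (suc c) w
length-heightsR c (r ∷ w) = cong suc (length-heightsR c w)

get-heightsR-≤ : ∀ c w i → get (heightsR c w) i ≤ c + countU w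
get-heightsR-≤ c []      i             = z≤n
get-heightsR-≤ c (u ∷ w) i             =
  subst (get (heightsR (suc c) w) i ≤_) (sym (+-suc c (countU w))) (get-heightsR-≤ (suc c) w i)
get-heightsR-≤ c (r ∷ w) zero          = z≤n
get-heightsR-≤ c (r ∷ w) (suc zero)    = m≤m+n c _
get-heightsR-≤ c (r ∷ w) (suc (suc i)) = get-heightsR-≤ c w (suc i)

endsWithU-∷ʳ-u : ∀ w → endsWithU (w ∷ʳ u) ≡ true
endsWithU-∷ʳ-u []           = refl
endsWithU-∷ʳ-u (u ∷ [])     = refl
endsWithU-∷ʳ-u (r ∷ [])     = refl
endsWithU-∷ʳ-u (u ∷ y ∷ w)  = endsWithU-∷ʳ-u (y ∷ w)
endsWithU-∷ʳ-u (r ∷ y ∷ w)  = endsWithU-∷ʳ-u (y ∷ w)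

endsWithU-∷ʳ-r : ∀ w → endsWithU (w ∷ʳ r) ≡ false
endsWithU-∷ʳ-r []           = refl
endsWithU-∷ʳ-r (u ∷ [])     = refl
endsWithU-∷ʳ-r (r ∷ [])     = refl
endsWithU-∷ʳ-r (u ∷ y ∷ w)  = endsWithU-∷ʳ-r (y ∷ w)
endsWithU-∷ʳ-r (r ∷ y ∷ w)  = endsWithU-∷ʳ-r (y ∷ w)

heightSeq-∷ʳ-u : ∀ w → heightSeq (w ∷ʳ u) ≡ heightsR 0 w ∷ʳ suc (countU w)
heightSeq-∷ʳ-u w rewrite endsWithU-∷ʳ-u w | heightsR-++ 0 w (u ∷ []) | ++-identityʳ (heightsR 0 w)
                       | countU-++ w (u ∷ []) | +-comm (countU w) 1 = refl

heightSeq-∷ʳ-r : ∀ w → heightSeq (w ∷ʳ r) ≡ heightsR 0 w ∷ʳ countU w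
heightSeq-∷ʳ-r w rewrite endsWithU-∷ʳ-r w | heightsR-++ 0 w (r ∷ []) = refl

data AscendingFrom : ℕ → List ℕ → Set where
  []  : ∀ {c} → AscendingFrom c []
  _∷_ : ∀ {c x xs} → c ≤ x → AscendingFrom x xs → AscendingFrom c (x ∷ xs)

ascendingFrom-weaken : ∀ {c' c xs} → c' ≤ c → AscendingFrom c xs → AscendingFrom c' xs
ascendingFrom-weaken c'≤c []             = []
ascendingFrom-weaken c'≤c (c≤x ∷ x≤xs) = ≤-trans c'≤c c≤x ∷ x≤xs

heightsR-ascending : ∀ c w → AscendingFrom c (heightsR c w)
heightsR-ascending c []      = []
heightsR-ascending c (u ∷ w) = ascendingFrom-weaken (n≤1+n c) (heightsR-ascending (suc c) w)
heightsR-ascending c (r ∷ w) = ≤-refl ∷ heightsR-ascending c w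

ascendingFrom⇒get-ascending : ∀ {c xs} → AscendingFrom c xs →
  ∀ i → 1 ≤ i → suc i ≤ length xs → get xs i ≤ get xs (suc i)
ascendingFrom⇒get-ascending (_ ∷ [])          (suc _)       _ (s≤s ())
ascendingFrom⇒get-ascending (_ ∷ (x≤y ∷ _))   (suc zero)    _ _       = x≤y
ascendingFrom⇒get-ascending (_ ∷ asc@(_ ∷ _)) (suc (suc i)) _ (s≤s p) =
  ascendingFrom⇒get-ascending asc (suc i) (s≤s z≤n) p

get-ascending⇒ascendingFrom : ∀ c xs → (1 ≤ length xs → c ≤ get xs 1) →
  (∀ i → 1 ≤ i → suc i ≤ length xs → get xs i ≤ get xs (suc i)) → AscendingFrom c xs
get-ascending⇒ascendingFrom c []       _    _   = []
get-ascending⇒ascendingFrom c (x ∷ xs) c≤x₁ asc =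
  c≤x₁ (s≤s z≤n) ∷ get-ascending⇒ascendingFrom x xs (λ p → asc 1 (s≤s z≤n) (s≤s p))
                     (λ { (suc i) _ p → asc (suc (suc i)) (s≤s z≤n) (s≤s p) })

Ballot : ℕ → ℕ → Word → Set
Ballot a b []      = ⊤
Ballot a b (u ∷ w) = Ballot (suc a) b w
Ballot a b (r ∷ w) = suc b ≤ a × Ballot a (suc b) w

PrefixBallot : ℕ → ℕ → Word → Set
PrefixBallot a b w = ∀ m → b + countR (take m w) ≤ a + countU (take m w)

prefixBallot⇒ballot : ∀ a b w → PrefixBallot a b w → Ballot a b w
prefixBallot⇒ballot a b []      _   = tt
prefixBallot⇒ballot a b (u ∷ w) pre =
  prefixBallot⇒ballot (suc a) b w (λ m → subst (b + countR (take m w) ≤_) (+-suc a _) (pre (suc m)))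
prefixBallot⇒ballot a b (r ∷ w) pre =
  subst₂ _≤_ (+-comm b 1) (+-identityʳ a) (pre 1) ,
  prefixBallot⇒ballot a (suc b) w (λ m → subst (_≤ a + countU (take m w)) (+-suc b _) (pre (suc m)))

ballot⇒prefixBallot : ∀ a b w → b ≤ a → Ballot a b w → PrefixBallot a b w
ballot⇒prefixBallot a b w       b≤a _ zero = +-mono-≤ b≤a ≤-refl
ballot⇒prefixBallot a b []      b≤a _ (suc m) = +-mono-≤ b≤a ≤-refl
ballot⇒prefixBallot a b (u ∷ w) b≤a bal (suc m) =
  subst (b + countR (take m w) ≤_) (sym (+-suc a _)) (ballot⇒prefixBallot (suc a) b w (m≤n⇒m≤1+n b≤a) bal m)
ballot⇒prefixBallot a b (r ∷ w) b≤a (b<a , bal) (suc m) =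
  subst (_≤ a + countU (take m w)) (sym (+-suc b _)) (ballot⇒prefixBallot a (suc b) w b<a bal m)

ballot-++⁻ˡ : ∀ a b xs ys → Ballot a b (xs ++ ys) → Ballot a b xs
ballot-++⁻ˡ a b []       ys _           = tt
ballot-++⁻ˡ a b (u ∷ xs) ys bal         = ballot-++⁻ˡ (suc a) b xs ys bal
ballot-++⁻ˡ a b (r ∷ xs) ys (b<a , bal) = b<a , ballot-++⁻ˡ a (suc b) xs ys bal

ballot-++⁻ʳ : ∀ a b xs ys → Ballot a b (xs ++ ys) → Ballot (a + countU xs) (b + countR xs) ys
ballot-++⁻ʳ a b []       ys bal =
  subst₂ (λ a' b' → Ballot a' b' ys) (sym (+-identityʳ a)) (sym (+-identityʳ b)) bal
ballot-++⁻ʳ a b (u ∷ xs) ys bal =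
  subst (λ a' → Ballot a' (b + countR xs) ys) (sym (+-suc a _)) (ballot-++⁻ʳ (suc a) b xs ys bal)
ballot-++⁻ʳ a b (r ∷ xs) ys (_ , bal) =
  subst (λ b' → Ballot (a + countU xs) b' ys) (sym (+-suc b _)) (ballot-++⁻ʳ a (suc b) xs ys bal)

ballot-++⁺ : ∀ a b xs ys → Ballot a b xs → Ballot (a + countU xs) (b + countR xs) ys → Ballot a b (xs ++ ys)
ballot-++⁺ a b []       ys _ bal =
  subst₂ (λ a' b' → Ballot a' b' ys) (+-identityʳ a) (+-identityʳ b) bal
ballot-++⁺ a b (u ∷ xs) ys balˣ bal =
  ballot-++⁺ (suc a) b xs ys balˣ (subst (λ a' → Ballot a' (b + countR xs) ys) (+-suc a _) bal)
ballot-++⁺ a b (r ∷ xs) ys (b<a , balˣ) bal =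
  b<a , ballot-++⁺ a (suc b) xs ys balˣ (subst (λ b' → Ballot (a + countU xs) b' ys) (+-suc b _) bal)

ballot-replicate-u : ∀ a b m → Ballot a b (replicate m u)
ballot-replicate-u a b zero    = tt
ballot-replicate-u a b (suc m) = ballot-replicate-u (suc a) b m

ballot⇒countR≤countU : ∀ a b w → b ≤ a → Ballot a b w → b + countR w ≤ a + countU w
ballot⇒countR≤countU a b w b≤a bal =
  subst (λ v → b + countR v ≤ a + countU v) (take-all (length w) w ≤-refl)
    (ballot⇒prefixBallot a b w b≤a bal (length w))

ballot⇒heightsR-above : ∀ a b w → Ballot a b w → ∀ i → 1 ≤ i → i ≤ countR w → b + i ≤ get (heightsR a w) i
ballot⇒heightsR-above a b []      _           (suc _)       _   ()
ballot⇒heightsR-above a b (u ∷ w) bal         i             1≤i i≤R       =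
  ballot⇒heightsR-above (suc a) b w bal i 1≤i i≤R
ballot⇒heightsR-above a b (r ∷ w) (b<a , _)   (suc zero)    _   _         = subst (_≤ a) (+-comm 1 b) b<a
ballot⇒heightsR-above a b (r ∷ w) (_ , bal)   (suc (suc i)) _   (s≤s i≤R) =
  subst (_≤ get (heightsR a w) (suc i)) (sym (+-suc b (suc i)))
    (ballot⇒heightsR-above a (suc b) w bal (suc i) (s≤s z≤n) i≤R)

m≤n⇒n+suc[m]≡2k⇒m<k : ∀ {n U R} → R ≤ U → U + suc R ≡ 2 * n → R < n
m≤n⇒n+suc[m]≡2k⇒m<k {n} {U} {R} R≤U U+1+R≡2n = ≰⇒> λ n≤R → <-irrefl refl (begin-strict
  2 * n        ≤⟨ +-mono-≤ (≤-trans n≤R R≤U) (subst (_≤ R) (sym (+-identityʳ n)) n≤R) ⟩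
  U + R        <⟨ +-monoʳ-< U (n<1+n R) ⟩
  U + suc R    ≡⟨ U+1+R≡2n ⟩
  2 * n        ∎)
  where open ≤-Reasoning

isHeightSeq-intro : ∀ n h k → length h ≡ k → 1 ≤ k → k ≤ n →
  (∀ i → 1 ≤ i → suc i ≤ k → get h i ≤ get h (suc i)) →
  (∀ i → 1 ≤ i → i ≤ k → i ≤ get h i) →
  (∀ i → 1 ≤ i → i < k → get h i + k ≤ 2 * n) →
  2 * n ≤ get h k + k → get h k + k ≤ suc (2 * n) → IsHeightSeq n h
isHeightSeq-intro n h .(length h) refl 1≤k k≤n asc above inner last≥ last≤ = record
  { length-pos = 1≤k ; length-≤ = k≤n ; ascending = asc ; above-diag = above
  ; inner-≤ = inner ; last-≥ = last≥ ; last-≤ = last≤ }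

isHeightSeq-∷ʳ : ∀ n L R U t → length L ≡ R →
  (∀ i → 1 ≤ i → suc i ≤ R → get L i ≤ get L (suc i)) →
  (∀ i → 1 ≤ i → i ≤ R → i ≤ get L i) →
  (∀ i → get L i ≤ U) → U + suc R ≤ 2 * n → suc R ≤ n → U ≤ t → suc R ≤ t →
  2 * n ≤ t + suc R → t + suc R ≤ suc (2 * n) → IsHeightSeq n (L ∷ʳ t)
isHeightSeq-∷ʳ n L R U t refl L-asc L-above L≤U U+k≤2n k≤n U≤t k≤t 2n≤t+k t+k≤1+2n =
  isHeightSeq-intro n (L ∷ʳ t) (suc R) (trans (length-++ L) (+-comm R 1)) (s≤s z≤n) k≤n ascending above-diag
    inner-≤
    (subst (λ v → 2 * n ≤ v + suc R) (sym (get-∷ʳ-last L t)) 2n≤t+k)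
    (subst (λ v → v + suc R ≤ suc (2 * n)) (sym (get-∷ʳ-last L t)) t+k≤1+2n)
  where
  get-init : ∀ i → i ≤ R → get (L ∷ʳ t) i ≡ get L i
  get-init i i≤R = get-++ˡ L (t ∷ []) i i≤R
  ascending : ∀ i → 1 ≤ i → suc i ≤ suc R → get (L ∷ʳ t) i ≤ get (L ∷ʳ t) (suc i)
  ascending i 1≤i (s≤s i≤R) with m≤n⇒m<n∨m≡n i≤R
  ... | inj₁ i<R  = subst₂ _≤_ (sym (get-init i i≤R)) (sym (get-init (suc i) i<R)) (L-asc i 1≤i i<R)
  ... | inj₂ refl = subst₂ _≤_ (sym (get-init i i≤R)) (sym (get-∷ʳ-last L t)) (≤-trans (L≤U i) U≤t)
  inner-≤ : ∀ i → 1 ≤ i → i < suc R → get (L ∷ʳ t) i + suc R ≤ 2 * n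
  inner-≤ i _ (s≤s i≤R) =
    subst (λ v → v + suc R ≤ 2 * n) (sym (get-init i i≤R)) (≤-trans (+-monoˡ-≤ (suc R) (L≤U i)) U+k≤2n)
  above-diag : ∀ i → 1 ≤ i → i ≤ suc R → i ≤ get (L ∷ʳ t) i
  above-diag i 1≤i i≤1+R with m≤n⇒m<n∨m≡n i≤1+R
  ... | inj₁ (s≤s i≤R) = subst (i ≤_) (sym (get-init i i≤R)) (L-above i 1≤i i≤R)
  ... | inj₂ refl      = subst (suc R ≤_) (sym (get-∷ʳ-last L t)) k≤t

heightSeq-isHeightSeq : ∀ n → 1 ≤ n → ∀ w → DyckB n w → IsHeightSeq n (heightSeq w)
heightSeq-isHeightSeq n 1≤n w (len , prefix) with initLast w
... | []       = contradiction len (<⇒≢ (≤-trans 1≤n (m≤m+n n (n + 0))))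
... | w ∷ʳ′ y = lastLetter y (ballot-++⁻ʳ 0 0 w (y ∷ []) bal)
  where
  bal = prefixBallot⇒ballot 0 0 (w ∷ʳ y) prefix
  U = countU w
  R = countR w
  L = heightsR 0 w
  R≤U : R ≤ U
  R≤U = ballot⇒countR≤countU 0 0 w z≤n (ballot-++⁻ˡ 0 0 w (y ∷ []) bal)
  U+1+R≡2n : U + suc R ≡ 2 * n
  U+1+R≡2n = begin
    U + suc R        ≡⟨ +-suc U R ⟩
    suc (U + R)      ≡⟨ cong suc (length≡countU+countR w) ⟨
    suc (length w)   ≡⟨ +-comm 1 (length w) ⟩
    length w + 1     ≡⟨ length-++ w ⟨
    length (w ∷ʳ y)  ≡⟨ len ⟩
    2 * n            ∎
    where open ≡-Reasoning
  isHeightSeq-L∷ʳ : ∀ t → U ≤ t → suc R ≤ t → 2 * n ≤ t + suc R → t + suc R ≤ suc (2 * n) →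
    IsHeightSeq n (L ∷ʳ t)
  isHeightSeq-L∷ʳ t = isHeightSeq-∷ʳ n L R U t (length-heightsR 0 w)
    (λ i 1≤i i<R → ascendingFrom⇒get-ascending (heightsR-ascending 0 w) i 1≤i
                     (subst (suc i ≤_) (sym (length-heightsR 0 w)) i<R))
    (ballot⇒heightsR-above 0 0 w (ballot-++⁻ˡ 0 0 w (y ∷ []) bal))
    (get-heightsR-≤ 0 w) (≤-reflexive U+1+R≡2n) (m≤n⇒n+suc[m]≡2k⇒m<k R≤U U+1+R≡2n)
  lastLetter : ∀ y → Ballot U R (y ∷ []) → IsHeightSeq n (heightSeq (w ∷ʳ y))
  lastLetter u _ rewrite heightSeq-∷ʳ-u w =
    isHeightSeq-L∷ʳ (suc U) (n≤1+n U) (s≤s R≤U) (≤-trans (≤-reflexive (sym U+1+R≡2n)) (n≤1+n _))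
      (≤-reflexive (cong suc U+1+R≡2n))
  lastLetter r (R<U , _) rewrite heightSeq-∷ʳ-r w =
    isHeightSeq-L∷ʳ U ≤-refl R<U (≤-reflexive (sym U+1+R≡2n)) (≤-trans (≤-reflexive U+1+R≡2n) (n≤1+n _))

wordOf : ℕ → List ℕ → Word
wordOf c []       = []
wordOf c (x ∷ xs) = replicate (x ∸ c) u ++ r ∷ wordOf x xs

lastOr : ℕ → List ℕ → ℕ
lastOr c []       = c
lastOr c (x ∷ xs) = lastOr x xs

climb : ∀ {c x} → c ≤ x → c + countU (replicate (x ∸ c) u) ≡ x
climb {c} {x} c≤x = trans (cong (c +_) (countU-replicate-u (x ∸ c))) (m+[n∸m]≡n c≤x)

heightsR-wordOf : ∀ {c xs} → AscendingFrom c xs → heightsR c (wordOf c xs) ≡ xs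
heightsR-wordOf []                       = refl
heightsR-wordOf {c} {x ∷ xs} (c≤x ∷ asc)
  rewrite heightsR-++ c (replicate (x ∸ c) u) (r ∷ wordOf x xs) | heightsR-replicate-u c (x ∸ c) | climb c≤x =
  cong (x ∷_) (heightsR-wordOf asc)

countU-wordOf : ∀ {c xs} → AscendingFrom c xs → c + countU (wordOf c xs) ≡ lastOr c xs
countU-wordOf {c} []                       = +-identityʳ c
countU-wordOf {c} {x ∷ xs} (c≤x ∷ asc)
  rewrite countU-++ (replicate (x ∸ c) u) (r ∷ wordOf x xs)
        | sym (+-assoc c (countU (replicate (x ∸ c) u)) (countU (wordOf x xs))) | climb c≤x = countU-wordOf asc

countR-wordOf : ∀ c xs → countR (wordOf c xs) ≡ length xs
countR-wordOf c []       = refl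
countR-wordOf c (x ∷ xs) rewrite countR-++ (replicate (x ∸ c) u) (r ∷ wordOf x xs) | countR-replicate-u (x ∸ c) =
  cong suc (countR-wordOf x xs)

ballot-wordOf : ∀ {c xs} b → AscendingFrom c xs → (∀ i → 1 ≤ i → i ≤ length xs → b + i ≤ get xs i) →
  Ballot c b (wordOf c xs)
ballot-wordOf b [] _ = tt
ballot-wordOf {c} {x ∷ xs} b (c≤x ∷ asc) above =
  ballot-++⁺ c b (replicate (x ∸ c) u) (r ∷ wordOf x xs) (ballot-replicate-u c b (x ∸ c))
    (subst₂ (λ a' b' → Ballot a' b' (r ∷ wordOf x xs)) (sym (climb c≤x))
            (sym (trans (cong (b +_) (countR-replicate-u (x ∸ c))) (+-identityʳ b)))
      (subst (_≤ x) (+-comm b 1) (above 1 (s≤s z≤n) (s≤s z≤n)) ,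
       ballot-wordOf (suc b) asc
         (λ { (suc i) _ i≤k → subst (_≤ get xs (suc i)) (+-suc b (suc i))
                                     (above (suc (suc i)) (s≤s z≤n) (s≤s i≤k)) })))

lastOr-∷ : ∀ x xs → lastOr x xs ≡ get (x ∷ xs) (suc (length xs))
lastOr-∷ x []        = refl
lastOr-∷ x (x' ∷ xs) = lastOr-∷ x' xs

lastOr-0 : ∀ xs → lastOr 0 xs ≡ get xs (length xs)
lastOr-0 []       = refl
lastOr-0 (x ∷ xs) = lastOr-∷ x xs

length-∷ʳ : ∀ w x → length (w ∷ʳ x) ≡ suc (countU w + countR w)
length-∷ʳ w x = trans (length-++ w) (trans (+-comm (length w) 1) (cong suc (length≡countU+countR w)))

ballot⇒dyckB : ∀ n w → length w ≡ 2 * n → Ballot 0 0 w → DyckB n w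
ballot⇒dyckB n w len bal = len , ballot⇒prefixBallot 0 0 w z≤n bal

module _ {h' : List ℕ} (asc : AscendingFrom 0 h') (above : ∀ i → 1 ≤ i → i ≤ length h' → i ≤ get h' i) where

  private
    k' = length h'
    L  = lastOr 0 h'
    padded : ℕ → Word
    padded m = wordOf 0 h' ++ replicate m u

  heightsR-padded : ∀ m → heightsR 0 (padded m) ≡ h'
  heightsR-padded m rewrite heightsR-++ 0 (wordOf 0 h') (replicate m u)
                          | heightsR-replicate-u (countU (wordOf 0 h')) m | ++-identityʳ (heightsR 0 (wordOf 0 h')) =
    heightsR-wordOf asc

  countU-padded : ∀ m → countU (padded m) ≡ L + m
  countU-padded m = trans (countU-++ (wordOf 0 h') (replicate m u))
                          (cong₂ _+_ (countU-wordOf asc) (countU-replicate-u m))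

  countR-padded : ∀ m → countR (padded m) ≡ k'
  countR-padded m = trans (countR-++ (wordOf 0 h') (replicate m u))
                          (trans (cong₂ _+_ (countR-wordOf 0 h') (countR-replicate-u m)) (+-identityʳ _))

  ballot-padded-∷ʳ : ∀ m x → Ballot (countU (padded m)) (countR (padded m)) (x ∷ []) → Ballot 0 0 (padded m ∷ʳ x)
  ballot-padded-∷ʳ m x = ballot-++⁺ 0 0 (padded m) (x ∷ [])
    (ballot-++⁺ 0 0 (wordOf 0 h') (replicate m u) (ballot-wordOf 0 asc above) (ballot-replicate-u _ _ m))

  realise-ending-r : ∀ n y → L ≤ y → suc k' ≤ y → y + suc k' ≡ 2 * n →
    Σ Word λ w → DyckB n w × heightSeq w ≡ h' ∷ʳ y
  realise-ending-r n y L≤y k≤y y+k≡2n =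
    A ∷ʳ r , ballot⇒dyckB n (A ∷ʳ r) length-w ballot-w ,
    trans (heightSeq-∷ʳ-r A) (cong₂ _∷ʳ_ (heightsR-padded m) countU-A)
    where
    m = y ∸ L
    A = padded m
    countU-A : countU A ≡ y
    countU-A = trans (countU-padded m) (m+[n∸m]≡n L≤y)
    length-w : length (A ∷ʳ r) ≡ 2 * n
    length-w = begin
      length (A ∷ʳ r)            ≡⟨ length-∷ʳ A r ⟩
      suc (countU A + countR A)  ≡⟨ cong₂ (λ a b → suc (a + b)) countU-A (countR-padded m) ⟩
      suc (y + k')               ≡⟨ +-suc y k' ⟨
      y + suc k'                 ≡⟨ y+k≡2n ⟩
      2 * n                      ∎
      where open ≡-Reasoning
    ballot-w = ballot-padded-∷ʳ m r (subst₂ (λ a b → suc b ≤ a) (sym countU-A) (sym (countR-padded m)) k≤y , tt)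

  realise-ending-u : ∀ n y → L < y → y + suc k' ≡ suc (2 * n) →
    Σ Word λ w → DyckB n w × heightSeq w ≡ h' ∷ʳ y
  realise-ending-u n y L<y y+k≡1+2n =
    A ∷ʳ u , ballot⇒dyckB n (A ∷ʳ u) length-w (ballot-padded-∷ʳ m u tt) ,
    trans (heightSeq-∷ʳ-u A) (cong₂ _∷ʳ_ (heightsR-padded m) 1+countU-A)
    where
    m = y ∸ suc L
    A = padded m
    1+countU-A : suc (countU A) ≡ y
    1+countU-A = trans (cong suc (countU-padded m)) (m+[n∸m]≡n L<y)
    length-w : length (A ∷ʳ u) ≡ 2 * n
    length-w = begin
      length (A ∷ʳ u)            ≡⟨ length-∷ʳ A u ⟩
      suc (countU A + countR A)  ≡⟨ cong₂ _+_ 1+countU-A (countR-padded m) ⟩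
      y + k'                     ≡⟨ suc-injective (trans (sym (+-suc y k')) y+k≡1+2n) ⟩
      2 * n                      ∎
      where open ≡-Reasoning

module _ {n : ℕ} {h' : List ℕ} {y : ℕ} (H : IsHeightSeq n (h' ∷ʳ y)) where

  private
    module H = IsHeightSeq H
    k' = length h'
    length-h : length (h' ∷ʳ y) ≡ suc k'
    length-h = trans (length-++ h') (+-comm k' 1)
    get-init : ∀ i → i ≤ k' → get (h' ∷ʳ y) i ≡ get h' i
    get-init i i≤k' = get-++ˡ h' (y ∷ []) i i≤k'
    get-last : get (h' ∷ʳ y) (length (h' ∷ʳ y)) ≡ y
    get-last = trans (cong (get (h' ∷ʳ y)) length-h) (get-∷ʳ-last h' y)

  init-ascending : AscendingFrom 0 h'
  init-ascending = get-ascending⇒ascendingFrom 0 h' (λ _ → z≤n) λ i 1≤i i<k' →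
    subst₂ _≤_ (get-init i (<⇒≤ i<k')) (get-init (suc i) i<k')
      (H.ascending i 1≤i (subst (suc i ≤_) (sym length-h) (m≤n⇒m≤1+n i<k')))

  init-above-diag : ∀ i → 1 ≤ i → i ≤ k' → i ≤ get h' i
  init-above-diag i 1≤i i≤k' =
    subst (i ≤_) (get-init i i≤k') (H.above-diag i 1≤i (subst (i ≤_) (sym length-h) (m≤n⇒m≤1+n i≤k')))

  last-≥ : 2 * n ≤ y + suc k'
  last-≥ = subst (2 * n ≤_) (cong₂ _+_ get-last length-h) H.last-≥

  last-≤ : y + suc k' ≤ suc (2 * n)
  last-≤ = subst (_≤ suc (2 * n)) (cong₂ _+_ get-last length-h) H.last-≤

  length≤last : suc k' ≤ y
  length≤last = subst₂ _≤_ length-h get-last (H.above-diag (length (h' ∷ʳ y)) H.length-pos ≤-refl)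

  lastOr-init+length≤2n : 1 ≤ n → lastOr 0 h' + suc k' ≤ 2 * n
  lastOr-init+length≤2n 1≤n with m≤n⇒m<n∨m≡n (z≤n {k'})
  ... | inj₁ 1≤k' =
    subst (λ v → v + suc k' ≤ 2 * n) (trans (get-init k' ≤-refl) (sym (lastOr-0 h')))
      (subst (λ j → get (h' ∷ʳ y) k' + j ≤ 2 * n) length-h
        (H.inner-≤ k' 1≤k' (subst (k' <_) (sym length-h) ≤-refl)))
  ... | inj₂ 0≡k' =
    subst (λ j → lastOr 0 h' + suc j ≤ 2 * n) 0≡k'
      (subst (λ v → v + 1 ≤ 2 * n) (sym (trans (lastOr-0 h') (trans (cong (get h') (sym 0≡k')) (get-0 h'))))
        (≤-trans 1≤n (m≤m+n n (n + 0))))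

heightSeq-surjective : ∀ n → 1 ≤ n → ∀ h → IsHeightSeq n h → Σ Word λ w → DyckB n w × heightSeq w ≡ h
heightSeq-surjective n 1≤n h H with initLast h
... | []        = contradiction (IsHeightSeq.length-pos H) λ ()
... | h' ∷ʳ′ y = realise (m≤n⇒m<n∨m≡n (last-≤ H))
  where
  k = suc (length h')
  L+k≤2n : lastOr 0 h' + k ≤ 2 * n
  L+k≤2n = lastOr-init+length≤2n H 1≤n
  realise : y + k < suc (2 * n) ⊎ y + k ≡ suc (2 * n) → Σ Word λ w → DyckB n w × heightSeq w ≡ h' ∷ʳ y
  realise (inj₁ (s≤s y+k≤2n)) =
    realise-ending-r (init-ascending H) (init-above-diag H) n y
      (+-cancelʳ-≤ k _ y (≤-trans L+k≤2n (last-≥ H))) (length≤last H) (≤-antisym y+k≤2n (last-≥ H))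
  realise (inj₂ y+k≡1+2n) =
    realise-ending-u (init-ascending H) (init-above-diag H) n y
      (+-cancelʳ-< k _ y (≤-<-trans L+k≤2n (≤-reflexive (sym y+k≡1+2n)))) y+k≡1+2n

theorem3p12 : (n : ℕ) → 1 ≤ n → (p₁ p₂ : Word) → DyckB n p₁ → DyckB n p₂ →
    Σ Word (λ p → IsRelPseudocomplement n p₁ p₂ p
                  × (heightSeq p ≡ rpcSeq n (heightSeq p₁) (heightSeq p₂)))
theorem3p12 n 1≤n p₁ p₂ d₁ d₂ = witness (heightSeq-surjective n 1≤n z isHeightSeq)
  where
  h₁ = heightSeq p₁
  h₂ = heightSeq p₂
  z  = rpcSeq n h₁ h₂
  H₁ = heightSeq-isHeightSeq n 1≤n p₁ d₁
  H₂ = heightSeq-isHeightSeq n 1≤n p₂ d₂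
  open RpcCandidateProperties H₁ H₂ (rpcSeq-rpcCandidate (IsHeightSeq.length-pos H₂))
  witness : Σ Word (λ p → DyckB n p × heightSeq p ≡ z) →
            Σ Word (λ p → IsRelPseudocomplement n p₁ p₂ p × heightSeq p ≡ z)
  witness (p , dyck-p , heightSeq-p≡z) =
    p , (dyck-p , subst (λ h → meetH h₁ h ≤D h₂) (sym heightSeq-p≡z) meetH-≤D ,
         λ w dyck-w meet≤ → subst (heightSeq w ≤D_) (sym heightSeq-p≡z)
                              (≤D-z (heightSeq-isHeightSeq n 1≤n w dyck-w) meet≤))
      , heightSeq-p≡z
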